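{- For all terms $M, L, N$: if $M\Rightarrow_{int}L$ and $L\to_{h\beta_v}N$ (resp. $L\to_{h\sigma}N$), then there exists a term $L'$ such that $M\to_{h\beta_v}L'$ (resp. $M\to_{h\sigma}L'$) and $L'\Rightarrow N$.
   Context: Terms and values of the call-by-value $\lambda$-calculus are defined by mutual induction from a countably infinite set of variables: values $V ::= x \mid \lambda x.M$ and terms $M,N,L ::= V \mid MN$, up to $\alpha$-conversion, application associating to the left; $\mathrm{fv}(M)$ is the set of free variables and $M\{V/x\}$ capture-avoiding substitution of a value. In all rules below $m\ge0$ and $V,V'$ range over values. Head $\beta_v$-reduction $\to_{h\beta_v}$: least relation with $(\lambda x.M)V M_1\dots M_m \to_{h\beta_v} M\{V/x\}M_1\dots M_m$, and if $N\to_{h\beta_v}N'$ then $VNM_1\dots M_m\to_{h\beta_v}VN'M_1\dots M_m$. Head $\sigma$-reduction $\to_{h\sigma}$: least relation with $(\lambda x.M)NLM_1\dots M_m\to_{h\sigma}(\lambda x.ML)NM_1\dots M_m$ ($x\notin\mathrm{fv}(L)$), $V((\lambda x.L)N)M_1\dots M_m\to_{h\sigma}(\lambda x.VL)NM_1\dots M_m$ ($x\notin\mathrm{fv}(V)$), and if $N\to_{h\sigma}N'$ then $VNM_1\dots M_m\to_{h\sigma}VN'M_1\dots M_m$. Parallel reduction $\Rightarrow$ is the least relation closed under: ($\beta_v$) if $V\Rightarrow V'$ and $M_i\Rightarrow M_i'$ for $0\le i\le m$ then $(\lambda x.M_0)VM_1\dots M_m\Rightarrow M_0'\{V'/x\}M_1'\dots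 M_m'$; ($\sigma_1$) if $N\Rightarrow N'$, $L\Rightarrow L'$, $M_i\Rightarrow M_i'$ for $0\le i\le m$, and $x\notin\mathrm{fv}(L)$, then $(\lambda x.M_0)NLM_1\dots M_m\Rightarrow(\lambda x.M_0'L')N'M_1'\dots M_m'$; ($\sigma_3$) if $V\Rightarrow V'$, $N\Rightarrow N'$, $L\Rightarrow L'$, $M_i\Rightarrow M_i'$ for $1\le i\le m$, and $x\notin\mathrm{fv}(V)$, then $V((\lambda x.L)N)M_1\dots M_m\Rightarrow(\lambda x.V'L')N'M_1'\dots M_m'$; ($\lambda$) if $M_i\Rightarrow M_i'$ for $0\le i\le m$ then $(\lambda x.M_0)M_1\dots M_m\Rightarrow(\lambda x.M_0')M_1'\dots M_m'$; (var) if $M_i\Rightarrow M_i'$ for $1\le i\le m$ then $xM_1\dots M_m\Rightarrow xM_1'\dots M_m'$. Internal parallel reduction $\Rightarrow_{int}$ is the least relation with: if $N\Rightarrow N'$ then $\lambda x.N\Rightarrow_{int}\lambda x.N'$; $x\Rightarrow_{int}x$; if $V\Rightarrow V'$, $N\Rightarrow_{int}N'$ and $M_i\Rightarrow M_i'$ for $1\le i\le m$, then $VNM_1\dots M_m\Rightarrow_{int}V'N'M_1'\dots M_m'$. -}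

module Defs where

open import Data.Nat using (ℕ; zero; suc)
open import Data.Fin using (Fin; zero; suc)
open import Data.List using (List; []; _∷_)

-- Call-by-value λ-calculus, values and terms by mutual induction.
-- Terms are well-scoped de Bruijn terms (α-conversion is built in):
-- Tm n / Val n have free variables among Fin n.

mutual
  data Val (n : ℕ) : Set where
    var : Fin n → Val n
    lam : Tm (suc n) → Val n

  data Tm (n : ℕ) : Set where
    val : Val n → Tm n
    app : Tm n → Tm n → Tm n

apps : ∀ {n} → Tm n → List (Tm n) → Tm n
apps M []       = M
apps M (N ∷ Ns) = apps (app M N) Ns

ext : ∀ {n m} → (Fin n → Fin m) → Fin (suc n) → Fin (suc m)
ext ρ zero    = zero
ext ρ (suc i) = suc (ρ i)

mutual
  renV : ∀ {n m} → (Fin n → Fin m) → Val n → Val m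
  renV ρ (var i) = var (ρ i)
  renV ρ (lam M) = lam (ren (ext ρ) M)

  ren : ∀ {n m} → (Fin n → Fin m) → Tm n → Tm m
  ren ρ (val V)   = val (renV ρ V)
  ren ρ (app M N) = app (ren ρ M) (ren ρ N)

-- weakening: a term of scope n seen under one more binder
-- (the variable bound by that binder is not free in it)
wkV : ∀ {n} → Val n → Val (suc n)
wkV = renV suc

wk : ∀ {n} → Tm n → Tm (suc n)
wk = ren suc

exts : ∀ {n m} → (Fin n → Val m) → Fin (suc n) → Val (suc m)
exts σ zero    = var zero
exts σ (suc i) = wkV (σ i)

mutual
  subV : ∀ {n m} → (Fin n → Val m) → Val n → Val m
  subV σ (var i) = σ i
  subV σ (lam M) = lam (sub (exts σ) M)

  sub : ∀ {n m} → (Fin n → Val m) → Tm n → Tm m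
  sub σ (val V)   = val (subV σ V)
  sub σ (app M N) = app (sub σ M) (sub σ N)

-- M{V/x} where x is the variable bound outermost (index zero)
sub0 : ∀ {n} → Val n → Fin (suc n) → Val n
sub0 V zero    = V
sub0 V (suc i) = var i

_[_] : ∀ {n} → Tm (suc n) → Val n → Tm n
M [ V ] = sub (sub0 V) M

data _→hβv_ {n : ℕ} : Tm n → Tm n → Set where
  β    : ∀ (M : Tm (suc n)) (V : Val n) (Ms : List (Tm n)) →
         apps (app (val (lam M)) (val V)) Ms →hβv apps (M [ V ]) Ms
  arg  : ∀ (V : Val n) {N N' : Tm n} (Ms : List (Tm n)) →
         N →hβv N' →
         apps (app (val V) N) Ms →hβv apps (app (val V) N') Ms

-- Head σ-reduction (side conditions x ∉ fv(_) are realised by weakening)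
data _→hσ_ {n : ℕ} : Tm n → Tm n → Set where
  σ₁   : ∀ (M : Tm (suc n)) (N L : Tm n) (Ms : List (Tm n)) →
         apps (app (app (val (lam M)) N) L) Ms →hσ
         apps (app (val (lam (app M (wk L)))) N) Ms
  σ₃   : ∀ (V : Val n) (L : Tm (suc n)) (N : Tm n) (Ms : List (Tm n)) →
         apps (app (val V) (app (val (lam L)) N)) Ms →hσ
         apps (app (val (lam (app (val (wkV V)) L))) N) Ms
  arg  : ∀ (V : Val n) {N N' : Tm n} (Ms : List (Tm n)) →
         N →hσ N' →
         apps (app (val V) N) Ms →hσ apps (app (val V) N') Ms

mutual
  data _⇒_ : ∀ {n} → Tm n → Tm n → Set where
    βv   : ∀ {n} {M₀ M₀' : Tm (suc n)} {V V' : Val n} {Ms Ms' : List (Tm n)} →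
           val V ⇒ val V' → M₀ ⇒ M₀' → Ms ⇒* Ms' →
           apps (app (val (lam M₀)) (val V)) Ms ⇒ apps (M₀' [ V' ]) Ms'
    σ₁   : ∀ {n} {M₀ M₀' : Tm (suc n)} {N N' L L' : Tm n} {Ms Ms' : List (Tm n)} →
           N ⇒ N' → L ⇒ L' → M₀ ⇒ M₀' → Ms ⇒* Ms' →
           apps (app (app (val (lam M₀)) N) L) Ms ⇒
           apps (app (val (lam (app M₀' (wk L')))) N') Ms'
    σ₃   : ∀ {n} {V V' : Val n} {N N' : Tm n} {L L' : Tm (suc n)} {Ms Ms' : List (Tm n)} →
           val V ⇒ val V' → N ⇒ N' → L ⇒ L' → Ms ⇒* Ms' →
           apps (app (val V) (app (val (lam L)) N)) Ms ⇒
           apps (app (val (lam (app (val (wkV V')) L'))) N') Ms'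
    lam  : ∀ {n} {M₀ M₀' : Tm (suc n)} {Ms Ms' : List (Tm n)} →
           M₀ ⇒ M₀' → Ms ⇒* Ms' →
           apps (val (lam M₀)) Ms ⇒ apps (val (lam M₀')) Ms'
    var  : ∀ {n} (x : Fin n) {Ms Ms' : List (Tm n)} →
           Ms ⇒* Ms' →
           apps (val (var x)) Ms ⇒ apps (val (var x)) Ms'

  data _⇒*_ : ∀ {n} → List (Tm n) → List (Tm n) → Set where
    []  : ∀ {n} → _⇒*_ {n} [] []
    _∷_ : ∀ {n} {M M' : Tm n} {Ms Ms' : List (Tm n)} →
          M ⇒ M' → Ms ⇒* Ms' → (M ∷ Ms) ⇒* (M' ∷ Ms')

data _⇒int_ : ∀ {n} → Tm n → Tm n → Set where
  lam : ∀ {n} {N N' : Tm (suc n)} →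
        N ⇒ N' → val (lam N) ⇒int val (lam N')
  var : ∀ {n} (x : Fin n) → val (var x) ⇒int val (var x)
  app : ∀ {n} {V V' : Val n} {N N' : Tm n} {Ms Ms' : List (Tm n)} →
        val V ⇒ val V' → N ⇒int N' → Ms ⇒* Ms' →
        apps (app (val V) N) Ms ⇒int apps (app (val V') N') Ms'

module Submission where

-- If M ⇒int L then either M is a value (and so is L, which has
-- no head step), or M = V N Ms and L = V' N' Ms' with V ⇒ V', N ⇒int N' and
-- Ms ⇒* Ms'.  Inverting the spine of L classifies its head step:
--   * a βv-, σ₁- or σ₃-redex at the root: by inversion M has a redex of the
--     same shape whose components reduce in parallel to those of L's redex;
--     firing it gives L', and L' ⇒ N follows from the substitutivity of ⇒
--     (for βv) resp. its closure under renaming and application (for σ);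
--   * a step inside the argument N': by induction on N ⇒int N'.

open import Defs
open import Data.Nat using (ℕ; suc)
open import Data.Product using (Σ; _×_; _,_)
open import Data.Fin using (Fin; zero; suc)
open import Data.List using (List; []; _∷_; map; _++_)
open import Data.List.Properties using (++-assoc; ++-identityʳ)
open import Data.Empty using (⊥; ⊥-elim)
open import Relation.Binary.PropositionalEquality
  using (_≡_; refl; sym; trans; cong; cong₂; subst₂)

Ren : ℕ → ℕ → Set
Ren n m = Fin n → Fin m

Subst : ℕ → ℕ → Set
Subst n m = Fin n → Val m

-- Each composite of two renaming/substitution operations is a
-- single operation, stated against any pointwise description of the
-- composite so that the lifted (ext/exts) versions fit the same statement.

ext-ext : ∀ {n m k} (ρ : Ren m k) (ρ' : Ren n m) (ρ'' : Ren n k) →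
          (∀ i → ρ (ρ' i) ≡ ρ'' i) → ∀ i → ext ρ (ext ρ' i) ≡ ext ρ'' i
ext-ext ρ ρ' ρ'' h zero    = refl
ext-ext ρ ρ' ρ'' h (suc i) = cong suc (h i)

mutual
  renV-renV : ∀ {n m k} (ρ : Ren m k) (ρ' : Ren n m) (ρ'' : Ren n k) →
              (∀ i → ρ (ρ' i) ≡ ρ'' i) → ∀ V → renV ρ (renV ρ' V) ≡ renV ρ'' V
  renV-renV ρ ρ' ρ'' h (var i) = cong var (h i)
  renV-renV ρ ρ' ρ'' h (lam M) =
    cong lam (ren-ren (ext ρ) (ext ρ') (ext ρ'') (ext-ext ρ ρ' ρ'' h) M)

  ren-ren : ∀ {n m k} (ρ : Ren m k) (ρ' : Ren n m) (ρ'' : Ren n k) →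
            (∀ i → ρ (ρ' i) ≡ ρ'' i) → ∀ M → ren ρ (ren ρ' M) ≡ ren ρ'' M
  ren-ren ρ ρ' ρ'' h (val V)   = cong val (renV-renV ρ ρ' ρ'' h V)
  ren-ren ρ ρ' ρ'' h (app M N) = cong₂ app (ren-ren ρ ρ' ρ'' h M) (ren-ren ρ ρ' ρ'' h N)

-- Weakening commutes with lifted renamings (the de Bruijn form of
-- "x ∉ fv(L) is preserved by renaming").
renV-wkV : ∀ {n m} (ρ : Ren n m) V → renV (ext ρ) (wkV V) ≡ wkV (renV ρ V)
renV-wkV ρ V = trans (renV-renV (ext ρ) suc (λ j → suc (ρ j)) (λ _ → refl) V)
                     (sym (renV-renV suc ρ (λ j → suc (ρ j)) (λ _ → refl) V))

ren-wk : ∀ {n m} (ρ : Ren n m) L → ren (ext ρ) (wk L) ≡ wk (ren ρ L)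
ren-wk ρ L = trans (ren-ren (ext ρ) suc (λ j → suc (ρ j)) (λ _ → refl) L)
                   (sym (ren-ren suc ρ (λ j → suc (ρ j)) (λ _ → refl) L))

exts-ext : ∀ {n m k} (σ : Subst m k) (ρ : Ren n m) (τ : Subst n k) →
           (∀ i → σ (ρ i) ≡ τ i) → ∀ i → exts σ (ext ρ i) ≡ exts τ i
exts-ext σ ρ τ h zero    = refl
exts-ext σ ρ τ h (suc i) = cong wkV (h i)

mutual
  subV-renV : ∀ {n m k} (σ : Subst m k) (ρ : Ren n m) (τ : Subst n k) →
              (∀ i → σ (ρ i) ≡ τ i) → ∀ V → subV σ (renV ρ V) ≡ subV τ V
  subV-renV σ ρ τ h (var i) = h i
  subV-renV σ ρ τ h (lam M) = cong lam (sub-ren (exts σ) (ext ρ) (exts τ) (exts-ext σ ρ τ h) M)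

  sub-ren : ∀ {n m k} (σ : Subst m k) (ρ : Ren n m) (τ : Subst n k) →
            (∀ i → σ (ρ i) ≡ τ i) → ∀ M → sub σ (ren ρ M) ≡ sub τ M
  sub-ren σ ρ τ h (val V)   = cong val (subV-renV σ ρ τ h V)
  sub-ren σ ρ τ h (app M N) = cong₂ app (sub-ren σ ρ τ h M) (sub-ren σ ρ τ h N)

ext-exts : ∀ {n m k} (ρ : Ren m k) (σ : Subst n m) (τ : Subst n k) →
           (∀ i → renV ρ (σ i) ≡ τ i) → ∀ i → renV (ext ρ) (exts σ i) ≡ exts τ i
ext-exts ρ σ τ h zero    = refl
ext-exts ρ σ τ h (suc i) = trans (renV-wkV ρ (σ i)) (cong wkV (h i))

mutual
  renV-subV : ∀ {n m k} (ρ : Ren m k) (σ : Subst n m) (τ : Subst n k) →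
              (∀ i → renV ρ (σ i) ≡ τ i) → ∀ V → renV ρ (subV σ V) ≡ subV τ V
  renV-subV ρ σ τ h (var i) = h i
  renV-subV ρ σ τ h (lam M) = cong lam (ren-sub (ext ρ) (exts σ) (exts τ) (ext-exts ρ σ τ h) M)

  ren-sub : ∀ {n m k} (ρ : Ren m k) (σ : Subst n m) (τ : Subst n k) →
            (∀ i → renV ρ (σ i) ≡ τ i) → ∀ M → ren ρ (sub σ M) ≡ sub τ M
  ren-sub ρ σ τ h (val V)   = cong val (renV-subV ρ σ τ h V)
  ren-sub ρ σ τ h (app M N) = cong₂ app (ren-sub ρ σ τ h M) (ren-sub ρ σ τ h N)

subV-wkV : ∀ {n m} (σ : Subst n m) V → subV (exts σ) (wkV V) ≡ wkV (subV σ V)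
subV-wkV σ V = trans (subV-renV (exts σ) suc (λ j → wkV (σ j)) (λ _ → refl) V)
                     (sym (renV-subV suc σ (λ j → wkV (σ j)) (λ _ → refl) V))

sub-wk : ∀ {n m} (σ : Subst n m) L → sub (exts σ) (wk L) ≡ wk (sub σ L)
sub-wk σ L = trans (sub-ren (exts σ) suc (λ j → wkV (σ j)) (λ _ → refl) L)
                   (sym (ren-sub suc σ (λ j → wkV (σ j)) (λ _ → refl) L))

exts-exts : ∀ {n m k} (σ : Subst m k) (τ : Subst n m) (υ : Subst n k) →
            (∀ i → subV σ (τ i) ≡ υ i) → ∀ i → subV (exts σ) (exts τ i) ≡ exts υ i
exts-exts σ τ υ h zero    = refl
exts-exts σ τ υ h (suc i) = trans (subV-wkV σ (τ i)) (cong wkV (h i))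

mutual
  subV-subV : ∀ {n m k} (σ : Subst m k) (τ : Subst n m) (υ : Subst n k) →
              (∀ i → subV σ (τ i) ≡ υ i) → ∀ V → subV σ (subV τ V) ≡ subV υ V
  subV-subV σ τ υ h (var i) = h i
  subV-subV σ τ υ h (lam M) = cong lam (sub-sub (exts σ) (exts τ) (exts υ) (exts-exts σ τ υ h) M)

  sub-sub : ∀ {n m k} (σ : Subst m k) (τ : Subst n m) (υ : Subst n k) →
            (∀ i → subV σ (τ i) ≡ υ i) → ∀ M → sub σ (sub τ M) ≡ sub υ M
  sub-sub σ τ υ h (val V)   = cong val (subV-subV σ τ υ h V)
  sub-sub σ τ υ h (app M N) = cong₂ app (sub-sub σ τ υ h M) (sub-sub σ τ υ h N)

exts-id : ∀ {n} (σ : Subst n n) → (∀ i → σ i ≡ var i) → ∀ i → exts σ i ≡ var i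
exts-id σ h zero    = refl
exts-id σ h (suc i) = cong wkV (h i)

mutual
  subV-id : ∀ {n} (σ : Subst n n) → (∀ i → σ i ≡ var i) → ∀ V → subV σ V ≡ V
  subV-id σ h (var i) = h i
  subV-id σ h (lam M) = cong lam (sub-id (exts σ) (exts-id σ h) M)

  sub-id : ∀ {n} (σ : Subst n n) → (∀ i → σ i ≡ var i) → ∀ M → sub σ M ≡ M
  sub-id σ h (val V)   = cong val (subV-id σ h V)
  sub-id σ h (app M N) = cong₂ app (sub-id σ h M) (sub-id σ h N)

ren-[] : ∀ {n m} (ρ : Ren n m) M V → ren ρ (M [ V ]) ≡ ren (ext ρ) M [ renV ρ V ]
ren-[] ρ M V = trans (ren-sub ρ (sub0 V) (λ i → renV ρ (sub0 V i)) (λ _ → refl) M)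
                     (sym (sub-ren (sub0 (renV ρ V)) (ext ρ) (λ i → renV ρ (sub0 V i)) agree M))
  where
  agree : ∀ i → sub0 (renV ρ V) (ext ρ i) ≡ renV ρ (sub0 V i)
  agree zero    = refl
  agree (suc i) = refl

sub-[] : ∀ {n m} (σ : Subst n m) M V → sub σ (M [ V ]) ≡ sub (exts σ) M [ subV σ V ]
sub-[] σ M V = trans (sub-sub σ (sub0 V) (λ i → subV σ (sub0 V i)) (λ _ → refl) M)
                     (sym (sub-sub (sub0 (subV σ V)) (exts σ) (λ i → subV σ (sub0 V i)) agree M))
  where
  -- substituting for the fresh variable of a weakened value has no effect
  agree : ∀ i → subV (sub0 (subV σ V)) (exts σ i) ≡ subV σ (sub0 V i)
  agree zero    = refl
  agree (suc i) = trans (subV-renV (sub0 (subV σ V)) suc var (λ _ → refl) (σ i))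
                        (subV-id var (λ _ → refl) (σ i))

ren-apps : ∀ {n m} (ρ : Ren n m) M Ms → ren ρ (apps M Ms) ≡ apps (ren ρ M) (map (ren ρ) Ms)
ren-apps ρ M []       = refl
ren-apps ρ M (N ∷ Ns) = ren-apps ρ (app M N) Ns

sub-apps : ∀ {n m} (σ : Subst n m) M Ms → sub σ (apps M Ms) ≡ apps (sub σ M) (map (sub σ) Ms)
sub-apps σ M []       = refl
sub-apps σ M (N ∷ Ns) = sub-apps σ (app M N) Ns

apps-++ : ∀ {n} (M : Tm n) Ms Ks → apps M (Ms ++ Ks) ≡ apps (apps M Ms) Ks
apps-++ M []       Ks = refl
apps-++ M (N ∷ Ns) Ks = apps-++ (app M N) Ns Ks

-- Spine inversion: every term is uniquely  val V M₁ … Mₘ.  The head value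
-- and the argument list are recovered by  head  and  args.

head : ∀ {n} → Tm n → Val n
head (val V)   = V
head (app M N) = head M

args : ∀ {n} → Tm n → List (Tm n)
args (val V)   = []
args (app M N) = args M ++ N ∷ []

head-apps : ∀ {n} (M : Tm n) Ms → head (apps M Ms) ≡ head M
head-apps M []       = refl
head-apps M (N ∷ Ns) = head-apps (app M N) Ns

args-apps : ∀ {n} (M : Tm n) Ms → args (apps M Ms) ≡ args M ++ Ms
args-apps M []       = sym (++-identityʳ (args M))
args-apps M (N ∷ Ns) = trans (args-apps (app M N) Ns) (++-assoc (args M) (N ∷ []) Ns)

spine-inj : ∀ {n} {V W : Val n} {Ms Ns} → apps (val V) Ms ≡ apps (val W) Ns → V ≡ W × Ms ≡ Ns
spine-inj {V = V} {W} {Ms} {Ns} eq =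
  trans (sym (head-apps (val V) Ms)) (trans (cong head eq) (head-apps (val W) Ns)) ,
  trans (sym (args-apps (val V) Ms)) (trans (cong args eq) (args-apps (val W) Ns))

apps-app≢val : ∀ {n} {M N : Tm n} {V} Ms → apps (app M N) Ms ≡ val V → ⊥
apps-app≢val []       ()
apps-app≢val (K ∷ Ks) eq = apps-app≢val Ks eq

⇒*-++ : ∀ {n} {Ms Ms' Ks Ks' : List (Tm n)} → Ms ⇒* Ms' → Ks ⇒* Ks' → (Ms ++ Ks) ⇒* (Ms' ++ Ks')
⇒*-++ []       es = es
⇒*-++ (d ∷ ds) es = d ∷ ⇒*-++ ds es

-- Every rule of ⇒ allows an arbitrary spine, so ⇒ is closed under adding
-- arguments in parallel.
⇒-apps : ∀ {n} {M M' : Tm n} {Ks Ks'} → M ⇒ M' → Ks ⇒* Ks' → apps M Ks ⇒ apps M' Ks'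
⇒-apps {Ks = Ks} {Ks'} (βv {Ms = Ms} {Ms'} dV dM ds) es =
  subst₂ _⇒_ (apps-++ _ Ms Ks) (apps-++ _ Ms' Ks') (βv dV dM (⇒*-++ ds es))
⇒-apps {Ks = Ks} {Ks'} (σ₁ {Ms = Ms} {Ms'} dN dL dM ds) es =
  subst₂ _⇒_ (apps-++ _ Ms Ks) (apps-++ _ Ms' Ks') (σ₁ dN dL dM (⇒*-++ ds es))
⇒-apps {Ks = Ks} {Ks'} (σ₃ {Ms = Ms} {Ms'} dV dN dL ds) es =
  subst₂ _⇒_ (apps-++ _ Ms Ks) (apps-++ _ Ms' Ks') (σ₃ dV dN dL (⇒*-++ ds es))
⇒-apps {Ks = Ks} {Ks'} (lam {Ms = Ms} {Ms'} dM ds) es =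
  subst₂ _⇒_ (apps-++ _ Ms Ks) (apps-++ _ Ms' Ks') (lam dM (⇒*-++ ds es))
⇒-apps {Ks = Ks} {Ks'} (var x {Ms} {Ms'} ds) es =
  subst₂ _⇒_ (apps-++ _ Ms Ks) (apps-++ _ Ms' Ks') (var x (⇒*-++ ds es))

⇒-app : ∀ {n} {M M' N N' : Tm n} → M ⇒ M' → N ⇒ N' → app M N ⇒ app M' N'
⇒-app d e = ⇒-apps d (e ∷ [])

mutual
  ⇒-ren : ∀ {n m} (ρ : Ren n m) {M M' : Tm n} → M ⇒ M' → ren ρ M ⇒ ren ρ M'
  ⇒-ren ρ (βv {M₀' = M₀'} {V' = V'} {Ms} {Ms'} dV dM ds) =
    subst₂ _⇒_ (sym (ren-apps ρ _ Ms))
      (sym (trans (ren-apps ρ _ Ms') (cong (λ X → apps X (map (ren ρ) Ms')) (ren-[] ρ M₀' V'))))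
      (βv (⇒-ren ρ dV) (⇒-ren (ext ρ) dM) (⇒*-ren ρ ds))
  ⇒-ren ρ (σ₁ {M₀' = M₀'} {N' = N'} {L' = L'} {Ms = Ms} {Ms'} dN dL dM ds) =
    subst₂ _⇒_ (sym (ren-apps ρ _ Ms))
      (sym (trans (ren-apps ρ _ Ms')
        (cong (λ X → apps (app (val (lam (app (ren (ext ρ) M₀') X))) (ren ρ N')) (map (ren ρ) Ms'))
              (ren-wk ρ L'))))
      (σ₁ (⇒-ren ρ dN) (⇒-ren ρ dL) (⇒-ren (ext ρ) dM) (⇒*-ren ρ ds))
  ⇒-ren ρ (σ₃ {V' = V'} {N' = N'} {L' = L'} {Ms = Ms} {Ms'} dV dN dL ds) =
    subst₂ _⇒_ (sym (ren-apps ρ _ Ms))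
      (sym (trans (ren-apps ρ _ Ms')
        (cong (λ X → apps (app (val (lam (app (val X) (ren (ext ρ) L')))) (ren ρ N')) (map (ren ρ) Ms'))
              (renV-wkV ρ V'))))
      (σ₃ (⇒-ren ρ dV) (⇒-ren ρ dN) (⇒-ren (ext ρ) dL) (⇒*-ren ρ ds))
  ⇒-ren ρ (lam {Ms = Ms} {Ms'} dM ds) =
    subst₂ _⇒_ (sym (ren-apps ρ _ Ms)) (sym (ren-apps ρ _ Ms')) (lam (⇒-ren (ext ρ) dM) (⇒*-ren ρ ds))
  ⇒-ren ρ (var x {Ms} {Ms'} ds) =
    subst₂ _⇒_ (sym (ren-apps ρ _ Ms)) (sym (ren-apps ρ _ Ms')) (var (ρ x) (⇒*-ren ρ ds))

  ⇒*-ren : ∀ {n m} (ρ : Ren n m) {Ms Ms' : List (Tm n)} → Ms ⇒* Ms' → map (ren ρ) Ms ⇒* map (ren ρ) Ms'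
  ⇒*-ren ρ []       = []
  ⇒*-ren ρ (d ∷ ds) = ⇒-ren ρ d ∷ ⇒*-ren ρ ds

_⇒ₛ_ : ∀ {n m} → Subst n m → Subst n m → Set
σ ⇒ₛ σ' = ∀ i → val (σ i) ⇒ val (σ' i)

⇒ₛ-exts : ∀ {n m} {σ σ' : Subst n m} → σ ⇒ₛ σ' → exts σ ⇒ₛ exts σ'
⇒ₛ-exts h zero    = var zero []
⇒ₛ-exts h (suc i) = ⇒-ren suc (h i)

mutual
  ⇒-sub : ∀ {n m} {σ σ' : Subst n m} → σ ⇒ₛ σ' → {M M' : Tm n} → M ⇒ M' → sub σ M ⇒ sub σ' M'
  ⇒-sub {σ = σ} {σ'} h (βv {M₀' = M₀'} {V' = V'} {Ms} {Ms'} dV dM ds) =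
    subst₂ _⇒_ (sym (sub-apps σ _ Ms))
      (sym (trans (sub-apps σ' _ Ms') (cong (λ X → apps X (map (sub σ') Ms')) (sub-[] σ' M₀' V'))))
      (βv (⇒-sub h dV) (⇒-sub (⇒ₛ-exts h) dM) (⇒*-sub h ds))
  ⇒-sub {σ = σ} {σ'} h (σ₁ {M₀' = M₀'} {N' = N'} {L' = L'} {Ms = Ms} {Ms'} dN dL dM ds) =
    subst₂ _⇒_ (sym (sub-apps σ _ Ms))
      (sym (trans (sub-apps σ' _ Ms')
        (cong (λ X → apps (app (val (lam (app (sub (exts σ') M₀') X))) (sub σ' N')) (map (sub σ') Ms'))
              (sub-wk σ' L'))))
      (σ₁ (⇒-sub h dN) (⇒-sub h dL) (⇒-sub (⇒ₛ-exts h) dM) (⇒*-sub h ds))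
  ⇒-sub {σ = σ} {σ'} h (σ₃ {V' = V'} {N' = N'} {L' = L'} {Ms = Ms} {Ms'} dV dN dL ds) =
    subst₂ _⇒_ (sym (sub-apps σ _ Ms))
      (sym (trans (sub-apps σ' _ Ms')
        (cong (λ X → apps (app (val (lam (app (val X) (sub (exts σ') L')))) (sub σ' N')) (map (sub σ') Ms'))
              (subV-wkV σ' V'))))
      (σ₃ (⇒-sub h dV) (⇒-sub h dN) (⇒-sub (⇒ₛ-exts h) dL) (⇒*-sub h ds))
  ⇒-sub {σ = σ} {σ'} h (lam {Ms = Ms} {Ms'} dM ds) =
    subst₂ _⇒_ (sym (sub-apps σ _ Ms)) (sym (sub-apps σ' _ Ms')) (lam (⇒-sub (⇒ₛ-exts h) dM) (⇒*-sub h ds))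
  ⇒-sub {σ = σ} {σ'} h (var x {Ms} {Ms'} ds) =
    subst₂ _⇒_ (sym (sub-apps σ _ Ms)) (sym (sub-apps σ' _ Ms')) (⇒-apps (h x) (⇒*-sub h ds))

  ⇒*-sub : ∀ {n m} {σ σ' : Subst n m} → σ ⇒ₛ σ' → {Ms Ms' : List (Tm n)} → Ms ⇒* Ms' →
           map (sub σ) Ms ⇒* map (sub σ') Ms'
  ⇒*-sub h []       = []
  ⇒*-sub h (d ∷ ds) = ⇒-sub h d ∷ ⇒*-sub h ds

⇒ₛ-sub0 : ∀ {n} {U W : Val n} → val U ⇒ val W → sub0 U ⇒ₛ sub0 W
⇒ₛ-sub0 d zero    = d
⇒ₛ-sub0 d (suc i) = var i []

⇒-[] : ∀ {n} {M M' : Tm (suc n)} {U W : Val n} → M ⇒ M' → val U ⇒ val W → (M [ U ]) ⇒ (M' [ W ])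
⇒-[] dM dU = ⇒-sub (⇒ₛ-sub0 dU) dM

⇒int⊆⇒ : ∀ {n} {M N : Tm n} → M ⇒int N → M ⇒ N
⇒int⊆⇒ (lam d)        = lam d []
⇒int⊆⇒ (var x)        = var x []
⇒int⊆⇒ (app dV dN ds) = ⇒-apps dV (⇒int⊆⇒ dN ∷ ds)

⇒-lam-inv : ∀ {n} {V : Val n} {P} → val V ⇒ val (lam P) → Σ (Tm (suc n)) (λ P₀ → V ≡ lam P₀ × P₀ ⇒ P)
⇒-lam-inv d = go d refl refl
  where
  go : ∀ {n} {T T' : Tm n} {V P} → T ⇒ T' → T ≡ val V → T' ≡ val (lam P) →
       Σ (Tm (suc n)) (λ P₀ → V ≡ lam P₀ × P₀ ⇒ P)
  go (βv {Ms = Ms} _ _ _)          e    _    = ⊥-elim (apps-app≢val Ms e)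
  go (σ₁ {Ms = Ms} _ _ _ _)        e    _    = ⊥-elim (apps-app≢val Ms e)
  go (σ₃ {Ms = Ms} _ _ _ _)        e    _    = ⊥-elim (apps-app≢val Ms e)
  go (lam d [])                    refl refl = _ , refl , d
  go (lam {Ms = _ ∷ Ms} _ (_ ∷ _)) e    _    = ⊥-elim (apps-app≢val Ms e)
  go (var x [])                    _    ()
  go (var x {Ms = _ ∷ Ms} (_ ∷ _)) e    _    = ⊥-elim (apps-app≢val Ms e)

⇒int-val-inv : ∀ {n} {N : Tm n} {W} → N ⇒int val W → Σ (Val n) (λ U → N ≡ val U × val U ⇒ val W)
⇒int-val-inv d = go d refl
  where
  go : ∀ {n} {N T : Tm n} {W} → N ⇒int T → T ≡ val W → Σ (Val n) (λ U → N ≡ val U × val U ⇒ val W)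
  go (lam d)                 refl = _ , refl , lam d []
  go (var x)                 refl = _ , refl , var x []
  go (app {Ms' = Ms'} _ _ _) e    = ⊥-elim (apps-app≢val Ms' e)

⇒int-redex-inv : ∀ {n} {N : Tm n} {P K} → N ⇒int app (val (lam P)) K →
                 Σ (Tm (suc n)) (λ P₀ → Σ (Tm n) (λ K₀ →
                   N ≡ app (val (lam P₀)) K₀ × P₀ ⇒ P × K₀ ⇒int K))
⇒int-redex-inv d = go d refl
  where
  go : ∀ {n} {N T : Tm n} {P K} → N ⇒int T → T ≡ app (val (lam P)) K →
       Σ (Tm (suc n)) (λ P₀ → Σ (Tm n) (λ K₀ → N ≡ app (val (lam P₀)) K₀ × P₀ ⇒ P × K₀ ⇒int K))
  go (app {V' = V'} {N' = K} {Ms' = Ms'} dV dK ds) e with spine-inj {V = V'} {Ms = K ∷ Ms'} {Ns = _ ∷ []} e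
  go (app dV dK []) e | refl , refl with ⇒-lam-inv dV
  ... | P₀ , refl , dP = P₀ , _ , refl , dP , dK

no-hβv-from-value : ∀ {n} {V : Val n} {R} → val V →hβv R → ⊥
no-hβv-from-value r = go r refl
  where
  go : ∀ {n} {M R : Tm n} {V} → M →hβv R → M ≡ val V → ⊥
  go (β _ _ Ms)    e = apps-app≢val Ms e
  go (arg _ Ms _)  e = apps-app≢val Ms e

no-hσ-from-value : ∀ {n} {V : Val n} {R} → val V →hσ R → ⊥
no-hσ-from-value r = go r refl
  where
  go : ∀ {n} {M R : Tm n} {V} → M →hσ R → M ≡ val V → ⊥
  go (σ₁ _ _ _ Ms) e = apps-app≢val Ms e
  go (σ₃ _ _ _ Ms) e = apps-app≢val Ms e
  go (arg _ Ms _)  e = apps-app≢val Ms e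

data βvStepOf {n} : Val n → Tm n → List (Tm n) → Tm n → Set where
  contract : ∀ P W Ms → βvStepOf (lam P) (val W) Ms (apps (P [ W ]) Ms)
  inside   : ∀ V {N N'} Ms → N →hβv N' → βvStepOf V N Ms (apps (app (val V) N') Ms)

βvStepOf-view : ∀ {n} {V : Val n} {N Ms R} → apps (app (val V) N) Ms →hβv R → βvStepOf V N Ms R
βvStepOf-view r = go r refl
  where
  go : ∀ {n} {M R : Tm n} {V N Ms} → M →hβv R → M ≡ apps (app (val V) N) Ms → βvStepOf V N Ms R
  go {V = V₀} {N₀} {Ms₀} (β P W Ks) e with spine-inj {W = V₀} {Ms = val W ∷ Ks} {Ns = N₀ ∷ Ms₀} e
  ... | refl , refl = contract P W Ks
  go {V = V₀} {N₀} {Ms₀} (arg V Ks r) e with spine-inj {W = V₀} {Ms = _ ∷ Ks} {Ns = N₀ ∷ Ms₀} e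
  ... | refl , refl = inside V Ks r

data σStepOf {n} : Val n → Tm n → List (Tm n) → Tm n → Set where
  root₁  : ∀ P N L Ms → σStepOf (lam P) N (L ∷ Ms) (apps (app (val (lam (app P (wk L)))) N) Ms)
  root₃  : ∀ V P K Ms → σStepOf V (app (val (lam P)) K) Ms
                                (apps (app (val (lam (app (val (wkV V)) P))) K) Ms)
  inside : ∀ V {N N'} Ms → N →hσ N' → σStepOf V N Ms (apps (app (val V) N') Ms)

σStepOf-view : ∀ {n} {V : Val n} {N Ms R} → apps (app (val V) N) Ms →hσ R → σStepOf V N Ms R
σStepOf-view r = go r refl
  where
  go : ∀ {n} {M R : Tm n} {V N Ms} → M →hσ R → M ≡ apps (app (val V) N) Ms → σStepOf V N Ms R
  go {V = V₀} {N₀} {Ms₀} (σ₁ P N L Ks) e with spine-inj {W = V₀} {Ms = N ∷ L ∷ Ks} {Ns = N₀ ∷ Ms₀} e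
  ... | refl , refl = root₁ P N L Ks
  go {V = V₀} {N₀} {Ms₀} (σ₃ V P K Ks) e with spine-inj {W = V₀} {Ms = app (val (lam P)) K ∷ Ks} {Ns = N₀ ∷ Ms₀} e
  ... | refl , refl = root₃ V P K Ks
  go {V = V₀} {N₀} {Ms₀} (arg V Ks r) e with spine-inj {W = V₀} {Ms = _ ∷ Ks} {Ns = N₀ ∷ Ms₀} e
  ... | refl , refl = inside V Ks r

postpone-hβv : ∀ {n} {M L N : Tm n} → M ⇒int L → L →hβv N → Σ (Tm n) (λ L' → (M →hβv L') × (L' ⇒ N))
postpone-hβv (lam _) r = ⊥-elim (no-hβv-from-value r)
postpone-hβv (var _) r = ⊥-elim (no-hβv-from-value r)
postpone-hβv (app {V' = V'} {N' = N'} {Ms = Ms} {Ms'} dV dN ds) r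
  with βvStepOf-view {V = V'} {N'} {Ms'} r
... | contract P W _ with ⇒-lam-inv dV | ⇒int-val-inv dN
...   | P₀ , refl , dP | U , refl , dU = apps (P₀ [ U ]) Ms , β P₀ U Ms , ⇒-apps (⇒-[] dP dU) ds
postpone-hβv (app {V = V} {Ms = Ms} dV dN ds) r | inside _ _ rN with postpone-hβv dN rN
... | N'' , rN' , dN'' = apps (app (val V) N'') Ms , arg V Ms rN' , ⇒-apps dV (dN'' ∷ ds)

-- Postponement of internal parallel steps after head σ-steps; the root
-- cases re-associate M exactly as the step re-associates L.
postpone-hσ : ∀ {n} {M L N : Tm n} → M ⇒int L → L →hσ N → Σ (Tm n) (λ L' → (M →hσ L') × (L' ⇒ N))
postpone-hσ (lam _) r = ⊥-elim (no-hσ-from-value r)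
postpone-hσ (var _) r = ⊥-elim (no-hσ-from-value r)
postpone-hσ (app {V' = V'} {N' = N'} {Ms' = Ms'} dV dN ds) r
  with σStepOf-view {V = V'} {N'} {Ms'} r
postpone-hσ (app {N = N} dV dN (_∷_ {M = L} {Ms = Ms} dL ds)) r | root₁ _ _ _ _ with ⇒-lam-inv dV
... | P₀ , refl , dP =
  apps (app (val (lam (app P₀ (wk L)))) N) Ms , σ₁ P₀ N L Ms ,
  ⇒-apps (lam (⇒-app dP (⇒-ren suc dL)) []) (⇒int⊆⇒ dN ∷ ds)
postpone-hσ (app {V = V} {Ms = Ms} dV dN ds) r | root₃ _ _ _ _ with ⇒int-redex-inv dN
... | P₀ , K₀ , refl , dP , dK =
  apps (app (val (lam (app (val (wkV V)) P₀))) K₀) Ms , σ₃ V P₀ K₀ Ms ,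
  ⇒-apps (lam (⇒-app (⇒-ren suc dV) dP) []) (⇒int⊆⇒ dK ∷ ds)
postpone-hσ (app {V = V} {Ms = Ms} dV dN ds) r | inside _ _ rN with postpone-hσ dN rN
... | N'' , rN' , dN'' = apps (app (val V) N'') Ms , arg V Ms rN' , ⇒-apps dV (dN'' ∷ ds)

lemma3p17 : ∀ {n : ℕ} (M L N : Tm n) → M ⇒int L →
            (L →hβv N → Σ (Tm n) (λ L' → (M →hβv L') × (L' ⇒ N)))
            × (L →hσ N → Σ (Tm n) (λ L' → (M →hσ L') × (L' ⇒ N)))
lemma3p17 M L N d = postpone-hβv d , postpone-hσ d
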